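{- Assume $m\ge2$. In the dependency graph $\Gamma_m$, the cyclic strongly connected components are exactly \[ U_m=\{(p,\infty):0\le p\le m-1\},\quad V_m=\{(p,q):0\le p,q\le m-1,\ q<p\}\cup\{(p,m-1):0\le p\le m-2\},\quad I_m=\{(\infty,m-1)\}. \] The sets $U_m$ and $V_m$ are strongly connected components, $I_m$ is a single vertex with a self-loop, and every vertex of $B_m^2\setminus(U_m\cup V_m\cup I_m)$ is a singleton strongly connected component without a self-loop. Consequently, after ordering the states by strongly connected components, the matrix $W_m(x)$ (and hence the system $F_m=x\mathbf 1+W_mF_m$) is block triangular, and the only cyclic components with more than one vertex are $U_m$ and $V_m$.
   Context: Let $\operatorname{Av}_j(132)$ be the set of permutations of length $j$ with no indices $i<j'<k$ such that $\pi_i<\pi_k<\pi_{j'}$. Fix $m\ge1$ and let $B_m=\{0,1,\ldots,m-1,\infty\}$, with $\infty-r=\infty$ for integers $r\ge0$. Set $c_{1,p}=1$ for $p\in B_m$ and, for $2\le k\le m$, $c_{k,p}=|\{\sigma\in\operatorname{Av}_{k-1}(132):k-\sigma_1\le p\}|$ (no condition if $p=\infty$). Let $W_m(x)$ be the matrix indexed by $B_m^2$ with entries $W_{(p,q),(r,s)}(x)=\sum_{k=1}^m c_{k,p}x^k\chi_{(r,s)=(m-k,q-k)}+x\chi_{(r,s)=(p-1,m-1)}$, indicators being $0$ when the pair has a negative coordinate. The dependency graph $\Gamma_m$ has vertex set $B_m^2$ and a directed edge $(r,s)\to(p,q)$ iff $W_{(p,q),(r,s)}(x)$ is not the zero polynomial.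 A strongly connected component is cyclic if it contains a directed cycle (i.e. has more than one vertex or is a singleton with a self-loop). The vector $F_m$ is the vector of state generating functions $F_{p,q}^{(m)}(x)=\sum_{n\ge1}T^{(m)}_{p,q}(n)x^n$, where $T^{(m)}_{p,q}(n)$ counts $132$-avoiding $\pi\in S_n$ with $|\pi_{i+1}-\pi_i|\le m$ for all $i$, $n-\pi_1\le p$ and $n-\pi_n\le q$, and $\mathbf 1$ is the all-ones vector. -}

module Defs where

open import Data.Nat as ℕ using (ℕ; zero; suc; _∸_; _+_; _*_)
import Data.Nat.Properties as ℕP
open import Data.Fin as Fin using (Fin; toℕ; fromℕ<)
import Data.Fin.Properties as FinP
open import Data.Vec using (Vec; []; _∷_; lookup)
open import Data.List using (List; []; _∷_; length; filter; map; concatMap; upTo; allFin)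
open import Data.Nat.ListAction using (sum)
open import Data.Maybe using (Maybe; just; nothing)
open import Data.Product using (_×_; _,_; ∃)
open import Data.Sum using (_⊎_)
open import Data.Unit using (⊤; tt)
open import Relation.Nullary using (¬_; Dec; yes; no; does)
open import Relation.Nullary.Decidable using (_×-dec_; _→-dec_; ¬?)
open import Relation.Binary.PropositionalEquality using (_≡_; _≢_; refl; cong)
open import Relation.Binary.Construct.Closure.ReflexiveTransitive using (Star)
open import Relation.Binary.Construct.Closure.Transitive using (TransClosure)

-- A permutation of length n is represented by its one-line notation as a
-- vector of values in Fin n (value v : Fin n stands for v+1 ∈ {1..n})
-- which is injective (hence bijective).
IsPerm : ∀ {n} → Vec (Fin n) n → Set
IsPerm {n} σ = (i j : Fin n) → lookup σ i ≡ lookup σ j → i ≡ j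

Avoids132 : ∀ {n} → Vec (Fin n) n → Set
Avoids132 {n} σ = (i j k : Fin n) → i Fin.< j → j Fin.< k →
  ¬ ((lookup σ i Fin.< lookup σ k) × (lookup σ k Fin.< lookup σ j))

isPerm? : ∀ {n} (σ : Vec (Fin n) n) → Dec (IsPerm σ)
isPerm? σ = FinP.all? λ i → FinP.all? λ j →
  (lookup σ i FinP.≟ lookup σ j) →-dec (i FinP.≟ j)

avoids132? : ∀ {n} (σ : Vec (Fin n) n) → Dec (Avoids132 σ)
avoids132? σ = FinP.all? λ i → FinP.all? λ j → FinP.all? λ k →
  (i FinP.<? j) →-dec ((j FinP.<? k) →-dec
    ¬? ((lookup σ i FinP.<? lookup σ k) ×-dec (lookup σ k FinP.<? lookup σ j)))

allVecs : ∀ {A : Set} → List A → (k : ℕ) → List (Vec A k)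
allVecs xs zero = [] ∷ []
allVecs xs (suc k) = concatMap (λ x → map (x ∷_) (allVecs xs k)) xs

-- Av_n(132), listed without repetition
Av132 : (n : ℕ) → List (Vec (Fin n) n)
Av132 n = filter (λ σ → isPerm? σ ×-dec avoids132? σ) (allVecs (allFin n) n)

data B (m : ℕ) : Set where
  fin : Fin m → B m
  ∞   : B m

_≟B_ : ∀ {m} (a b : B m) → Dec (a ≡ b)
fin i ≟B fin j with i FinP.≟ j
... | yes refl = yes refl
... | no ne = no λ { refl → ne refl }
fin i ≟B ∞ = no λ ()
∞ ≟B fin j = no λ ()
∞ ≟B ∞ = yes refl

finB : (m j : ℕ) → Maybe (B m)
finB m j with j ℕP.<? m
... | yes j<m = just (fin (fromℕ< j<m))
... | no _ = nothing

_⊖_ : ∀ {m} → B m → ℕ → Maybe (B m)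
_⊖_ {m} (fin j) r with r ℕP.≤? toℕ j
... | yes _ = finB m (toℕ j ∸ r)
... | no _ = nothing
∞ ⊖ r = just ∞

-- the condition  k - σ₁ ≤ p  (σ₁ is the 1-based first value v+1)
FirstCond : ∀ {m} → (k : ℕ) → B m → ∀ {n} → Fin n → Set
FirstCond k (fin p) v = k ∸ suc (toℕ v) ℕ.≤ toℕ p
FirstCond k ∞ v = ⊤

firstCond? : ∀ {m} (k : ℕ) (p : B m) {n} (v : Fin n) → Dec (FirstCond k p v)
firstCond? k (fin p) v = k ∸ suc (toℕ v) ℕP.≤? toℕ p
firstCond? k ∞ v = yes tt

c : ∀ {m} → (k : ℕ) → B m → ℕ
c zero p = 0   -- never used (k ranges over 1..m)
c (suc zero) p = 1
c (suc (suc n)) p =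
  length (filter (λ σ → firstCond? (suc (suc n)) p (lookup σ Fin.zero)) (Av132 (suc n)))

Vertex : ℕ → Set
Vertex m = B m × B m

-- indicator χ_{(r,s) = (a,b)}, which is 0 if a or b is negative (nothing)
χ : ∀ {m} → Vertex m → Maybe (B m) → Maybe (B m) → ℕ
χ (r , s) (just a) (just b) with r ≟B a | s ≟B b
... | yes _ | yes _ = 1
... | _ | _ = 0
χ _ _ _ = 0

δ : ℕ → ℕ → ℕ
δ n k with n ℕP.≟ k
... | yes _ = 1
... | no _ = 0

-- coefficient of x^n in W_{(p,q),(r,s)}(x)
--   = Σ_{k=1}^m c_{k,p} x^k χ_{(r,s)=(m-k,q-k)} + x χ_{(r,s)=(p-1,m-1)}
Wcoeff : (m : ℕ) → Vertex m → Vertex m → ℕ → ℕ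
Wcoeff m (p , q) rs n =
  sum (map (λ i → c (suc i) p * δ n (suc i) * χ rs (finB m (m ∸ suc i)) (q ⊖ suc i)) (upTo m))
  + δ n 1 * χ rs (p ⊖ 1) (finB m (m ∸ 1))

NonZeroPoly : (ℕ → ℕ) → Set
NonZeroPoly f = ∃ λ n → f n ≢ 0

Edge : (m : ℕ) → Vertex m → Vertex m → Set
Edge m rs pq = NonZeroPoly (Wcoeff m pq rs)

Reach : (m : ℕ) → Vertex m → Vertex m → Set
Reach m = Star (Edge m)

SameSCC : (m : ℕ) → Vertex m → Vertex m → Set
SameSCC m u v = Reach m u v × Reach m v u

IsSCC : (m : ℕ) → (Vertex m → Set) → Set
IsSCC m S = (∃ λ u → S u)
  × (∀ u v → S u → S v → SameSCC m u v)
  × (∀ u v → S u → SameSCC m u v → S v)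

OnCycle : (m : ℕ) → Vertex m → Set
OnCycle m v = TransClosure (Edge m) v v

InU : ∀ {m} → Vertex m → Set
InU (fin p , ∞) = ⊤
InU _ = Data.Empty.⊥
  where import Data.Empty

InV : ∀ {m} → Vertex m → Set
InV {m} (fin p , fin q) = (toℕ q ℕ.< toℕ p) ⊎ ((toℕ q ≡ m ∸ 1) × (toℕ p ℕ.≤ m ∸ 2))
InV _ = Data.Empty.⊥
  where import Data.Empty

InI : ∀ {m} → Vertex m → Set
InI {m} (∞ , fin q) = toℕ q ≡ m ∸ 1
InI _ = Data.Empty.⊥
  where import Data.Empty

{-# OPTIONS --safe #-}
module Submission where

-- Reading off W_m, there is an edge (r,s) → (p,q) iff (r,s) = (m-k, q-k) for some
-- 1 ≤ k ≤ m with c_{k,p} ≥ 1, or (r,s) = (p-1, m-1).  So every edge starts in U ∪ V ∪ I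
-- and all other vertices are sinks.  Edges leaving U end in U or in the sink (∞,∞), and
-- edges leaving I end in I or in a sink (∞,q); hence U and I are unions of components,
-- and the component of a vertex of V stays inside V.  Strong connectivity comes from
-- explicit paths through (m-1,∞) in U and (m-1,m-2) in V, using c_{k,p} ≥ 1 for k ≤ p+1.

open import Defs
open import Data.Nat using (ℕ; zero; suc; _+_; _*_; _∸_; _≤_; _<_; z≤n; s≤s)
open import Data.Nat.Properties
  using (_≟_; _<?_; _≤?_; ≤-trans; ≤-pred; ≤∧≢⇒<; n≤1+n; n<1+n; m≤m+n; m≤n+m; m∸n≤m;
         ∸-monoˡ-≤; ∸-monoʳ-≤; +-suc; +-comm; +-monoˡ-<; +-cancelʳ-<; m+[n∸m]≡n; m∸n+n≡m;
         m+n∸n≡m; *-identityʳ; *-zeroʳ; n≢0⇒n>0; n>0⇒n≢0; module ≤-Reasoning)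
open import Data.Nat.ListAction using (sum)
open import Data.Fin using (Fin; zero; suc; toℕ; fromℕ; fromℕ<; inject₁)
open import Data.Fin.Properties
  using (<-asym; toℕ<n; toℕ≤pred[n]; fromℕ<-toℕ; toℕ-fromℕ; toℕ-fromℕ<; toℕ-inject₁)
open import Data.Vec using (Vec; []; _∷_; allFin)
open import Data.Vec.Properties using (lookup-allFin)
open import Data.List using (List; []; _∷_; map; upTo)
open import Data.List.Relation.Unary.Any using (Any; here; there)
open import Data.List.Membership.Propositional using (_∈_; find; lose)
open import Data.List.Membership.Propositional.Properties
  using (∈-concatMap⁺; ∈-map⁺; ∈-filter⁺; ∈-allFin; ∈-length; ∈-upTo⁺; ∈-upTo⁻)
open import Data.Maybe using (just; nothing)
open import Data.Product using (_×_; _,_; ∃; proj₁; proj₂)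
open import Data.Sum using (_⊎_; inj₁; inj₂)
open import Data.Unit using (tt)
open import Function using (_∘_)
open import Relation.Nullary using (¬_; Dec; yes; no; contradiction)
open import Relation.Binary.PropositionalEquality
  using (_≡_; _≢_; refl; sym; trans; cong; subst; subst₂)
open import Relation.Binary.Construct.Closure.ReflexiveTransitive as Star
  using (Star; ε; _◅_; _◅◅_)
open import Relation.Binary.Construct.Closure.Transitive using ([_]; _∷_)

module _ {A : Set} (R : A → A → Set) where

  Sink : A → Set
  Sink v = ∀ w → ¬ R v w

  ClosedUpToSinks : (A → Set) → Set
  ClosedUpToSinks P = ∀ {u w} → P u → R u w → P w ⊎ Sink w

  sink-reach : ∀ {v w} → Sink v → Star R v w → w ≡ v
  sink-reach sink ε = refl
  sink-reach sink (_◅_ {j = w} e _) = contradiction e (sink w)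

  closedUpToSinks-reach : ∀ {P} → ClosedUpToSinks P → ∀ {u v} → P u → Star R u v → P v ⊎ Sink v
  closedUpToSinks-reach closed Pu ε = inj₁ Pu
  closedUpToSinks-reach closed Pu (e ◅ w→v) with closed Pu e
  ... | inj₁ Pw = closedUpToSinks-reach closed Pw w→v
  ... | inj₂ sink with refl ← sink-reach sink w→v = inj₂ sink

  closedUpToSinks⇒SCC-closed : ∀ {P} → ClosedUpToSinks P →
                               ∀ {u v} → P u → Star R u v → Star R v u → P v
  closedUpToSinks⇒SCC-closed closed Pu u→v v→u with closedUpToSinks-reach closed Pu u→v
  ... | inj₁ Pv = Pv
  ... | inj₂ sink with refl ← sink-reach sink v→u = Pu

∈-allVecs : ∀ {A : Set} {xs : List A} → (∀ a → a ∈ xs) → ∀ {k} (v : Vec A k) → v ∈ allVecs xs k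
∈-allVecs every [] = here refl
∈-allVecs every (a ∷ v) = ∈-concatMap⁺ _ (lose (every a) (∈-map⁺ (a ∷_) (∈-allVecs every v)))

allFin-isPerm : ∀ n → IsPerm (allFin n)
allFin-isPerm n i j eq rewrite lookup-allFin i | lookup-allFin j = eq

allFin-avoids132 : ∀ n → Avoids132 (allFin n)
allFin-avoids132 n i j k i<j j<k (_ , σk<σj)
  rewrite lookup-allFin j | lookup-allFin k = <-asym j<k σk<σj

allFin∈Av132 : ∀ n → allFin n ∈ Av132 n
allFin∈Av132 n = ∈-filter⁺ _ (∈-allVecs ∈-allFin (allFin n)) (allFin-isPerm n , allFin-avoids132 n)

-- The identity permutation witnesses c_{i+1,p} ≥ 1 (its first value is 1).
c-pos : ∀ {m i} {p : Fin m} → i ≤ toℕ p → 0 < c (suc i) (fin p)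
c-pos {i = zero} _ = s≤s z≤n
c-pos {i = suc i} i≤p = ∈-length (∈-filter⁺ _ (allFin∈Av132 (suc i)) i≤p)

-- Minus a k b says b = a - k in B_m, i.e. a ⊖ k ≡ just b.
data Minus {m} : B m → ℕ → B m → Set where
  finite   : ∀ {a b k} → toℕ b + k ≡ toℕ a → Minus (fin a) k (fin b)
  infinite : ∀ {k} → Minus ∞ k ∞

finB-sound : ∀ {m j} {b : B m} → finB m j ≡ just b → ∃ λ x → b ≡ fin x × toℕ x ≡ j
finB-sound {m} {j} eq with j <? m
finB-sound refl | yes j<m = fromℕ< j<m , refl , toℕ-fromℕ< j<m
finB-sound ()   | no _

finB-complete : ∀ {m j} {x : Fin m} → toℕ x ≡ j → finB m j ≡ just (fin x)
finB-complete {m} {x = x} refl with toℕ x <? m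
... | yes x<m = cong (just ∘ fin) (fromℕ<-toℕ x x<m)
... | no x≮m = contradiction (toℕ<n x) x≮m

⊖-sound : ∀ {m} {a b : B m} {k} → a ⊖ k ≡ just b → Minus a k b
⊖-sound {a = ∞} refl = infinite
⊖-sound {a = fin a} {k = k} eq with k ≤? toℕ a
... | no _ with () ← eq
... | yes k≤a with x , refl , x≡a-k ← finB-sound eq =
  finite (trans (cong (_+ k) x≡a-k) (m∸n+n≡m k≤a))

⊖-complete : ∀ {m} {a b : B m} {k} → Minus a k b → a ⊖ k ≡ just b
⊖-complete infinite = refl
⊖-complete {a = fin a} {fin b} {k} (finite b+k≡a) with k ≤? toℕ a
... | yes _ = finB-complete (sym (trans (cong (_∸ k) (sym b+k≡a)) (m+n∸n≡m (toℕ b) k)))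
... | no k≰a = contradiction (subst (k ≤_) b+k≡a (m≤n+m k (toℕ b))) k≰a

δ-refl : ∀ n → δ n n ≡ 1
δ-refl n with n ≟ n
... | yes _ = refl
... | no n≢n = contradiction refl n≢n

χ-refl : ∀ {m} (r s : B m) → χ (r , s) (just r) (just s) ≡ 1
χ-refl r s with r ≟B r | s ≟B s
... | yes _ | yes _ = refl
... | no r≢r | _ = contradiction refl r≢r
... | yes _ | no s≢s = contradiction refl s≢s

χ≢0⇒ : ∀ {m} {r s : B m} {ma mb} → χ (r , s) ma mb ≢ 0 → ma ≡ just r × mb ≡ just s
χ≢0⇒ {r = r} {s} {just a} {just b} χ≢0 with r ≟B a | s ≟B b
... | yes refl | yes refl = refl , refl
... | yes _ | no _ = contradiction refl χ≢0
... | no _ | _ = contradiction refl χ≢0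
χ≢0⇒ {ma = just _} {nothing} χ≢0 = contradiction refl χ≢0
χ≢0⇒ {ma = nothing} χ≢0 = contradiction refl χ≢0

+≢0⇒ : ∀ a {b} → a + b ≢ 0 → a ≢ 0 ⊎ b ≢ 0
+≢0⇒ zero b≢0 = inj₂ b≢0
+≢0⇒ (suc a) _ = inj₁ λ ()

*≢0⇒ : ∀ a {b} → a * b ≢ 0 → a ≢ 0 × b ≢ 0
*≢0⇒ a {b} ab≢0 =
  (λ a≡0 → ab≢0 (cong (_* b) a≡0)) , (λ b≡0 → ab≢0 (trans (cong (a *_) b≡0) (*-zeroʳ a)))

sum-map≢0⇒ : ∀ (f : ℕ → ℕ) xs → sum (map f xs) ≢ 0 → Any (λ x → f x ≢ 0) xs
sum-map≢0⇒ f [] Σ≢0 = contradiction refl Σ≢0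
sum-map≢0⇒ f (x ∷ xs) Σ≢0 with +≢0⇒ (f x) Σ≢0
... | inj₁ fx≢0 = here fx≢0
... | inj₂ Σ′≢0 = there (sum-map≢0⇒ f xs Σ′≢0)

∈⇒≤sum-map : ∀ (f : ℕ → ℕ) {x xs} → x ∈ xs → f x ≤ sum (map f xs)
∈⇒≤sum-map f (here refl) = m≤m+n _ _
∈⇒≤sum-map f {xs = y ∷ _} (there x∈xs) = ≤-trans (∈⇒≤sum-map f x∈xs) (m≤n+m _ (f y))

-- The two kinds of terms of W_{v,u}(x), v = (p,q), that can be nonzero:
-- c_{k+1,p} x^{k+1} χ_{u=(m-k-1,q-k-1)} and x χ_{u=(p-1,m-1)}.
data Step (m : ℕ) : Vertex m → Vertex m → Set where
  c-term : ∀ {x s p q} k → toℕ x + suc k ≡ m → Minus q (suc k) s → 0 < c (suc k) p →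
           Step m (fin x , s) (p , q)
  x-term : ∀ {r y p q} → Minus p 1 r → toℕ y ≡ m ∸ 1 → Step m (r , fin y) (p , q)

c-term-from-χ : ∀ {m r s p q} k → k < m → finB m (m ∸ suc k) ≡ just r → q ⊖ suc k ≡ just s →
                0 < c (suc k) p → Step m (r , s) (p , q)
c-term-from-χ k k<m r≡ s≡ c>0 with x , refl , x≡ ← finB-sound r≡ =
  c-term k (trans (cong (_+ suc k) x≡) (m∸n+n≡m k<m)) (⊖-sound s≡) c>0

x-term-from-χ : ∀ {m r s p q} → p ⊖ 1 ≡ just r → finB m (m ∸ 1) ≡ just s → Step m (r , s) (p , q)
x-term-from-χ r≡ s≡ with y , refl , y≡ ← finB-sound s≡ = x-term (⊖-sound r≡) y≡

edge⇒step : ∀ {m} {u v : Vertex m} → Edge m u v → Step m u v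
edge⇒step {m} {r , s} {p , q} (n , W≢0) = from-summands (+≢0⇒ (sum (map term (upTo m))) W≢0)
  where
  term : ℕ → ℕ
  term i = c (suc i) p * δ n (suc i) * χ (r , s) (finB m (m ∸ suc i)) (q ⊖ suc i)

  from-summands : sum (map term (upTo m)) ≢ 0 ⊎ δ n 1 * χ (r , s) (p ⊖ 1) (finB m (m ∸ 1)) ≢ 0 →
                  Step m (r , s) (p , q)
  from-summands (inj₁ Σ≢0) =
    let i , i∈ , term≢0 = find (sum-map≢0⇒ term (upTo m) Σ≢0)
        cδ≢0 , χ≢0 = *≢0⇒ (c (suc i) p * δ n (suc i)) term≢0
        r≡ , s≡ = χ≢0⇒ χ≢0
    in c-term-from-χ i (∈-upTo⁻ i∈) r≡ s≡ (n≢0⇒n>0 (proj₁ (*≢0⇒ (c (suc i) p) cδ≢0)))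
  from-summands (inj₂ x≢0) = let r≡ , s≡ = χ≢0⇒ (proj₂ (*≢0⇒ (δ n 1) x≢0)) in x-term-from-χ r≡ s≡

step⇒edge : ∀ {m} {u v : Vertex m} → Step m u v → Edge m u v
step⇒edge {m} (c-term {x} {s} {p} {q} k x+k≡m q-k≡s c>0) = suc k , n>0⇒n≢0 (begin-strict
  0                                 <⟨ c>0 ⟩
  c (suc k) p                       ≡⟨ term-k≡c ⟨
  term k                            ≤⟨ ∈⇒≤sum-map term (∈-upTo⁺ k<m) ⟩
  sum (map term (upTo m))           ≤⟨ m≤m+n _ _ ⟩
  Wcoeff m (p , q) (fin x , s) (suc k) ∎)
  where
  open ≤-Reasoning
  term : ℕ → ℕ
  term i = c (suc i) p * δ (suc k) (suc i) * χ (fin x , s) (finB m (m ∸ suc i)) (q ⊖ suc i)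

  k<m : k < m
  k<m = subst (k <_) x+k≡m (m≤n+m (suc k) (toℕ x))

  term-k≡c : term k ≡ c (suc k) p
  term-k≡c rewrite δ-refl (suc k)
                 | finB-complete {x = x}
                     (sym (trans (cong (_∸ suc k) (sym x+k≡m)) (m+n∸n≡m (toℕ x) (suc k))))
                 | ⊖-complete q-k≡s | χ-refl (fin x) s
                 = trans (*-identityʳ _) (*-identityʳ _)
step⇒edge {m} (x-term {r} {y} {p} {q} p-1≡r y≡m-1) = 1 , n>0⇒n≢0 x-summand>0
  where
  x-summand>0 : 0 < Wcoeff m (p , q) (r , fin y) 1
  x-summand>0 rewrite ⊖-complete p-1≡r | finB-complete y≡m-1 | χ-refl r (fin y) = m≤n+m 1 _

InUVI : ∀ {m} → Vertex m → Set
InUVI v = InU v ⊎ InV v ⊎ InI v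

step-source-InUVI : ∀ {m} {u v : Vertex m} → Step m u v → InUVI u
step-source-InUVI (c-term {x} k x+k≡m (finite {z} {y} y+k≡z) _) =
  inj₂ (inj₁ (inj₁ (+-cancelʳ-< (suc k) (toℕ y) (toℕ x)
                      (subst₂ _<_ (sym y+k≡z) (sym x+k≡m) (toℕ<n z)))))
step-source-InUVI (c-term _ _ infinite _) = inj₁ tt
step-source-InUVI {m} (x-term (finite {z} {x} x+1≡z) y≡m-1) =
  inj₂ (inj₁ (inj₂ (y≡m-1 , ∸-monoˡ-≤ 2 (subst (λ t → suc t ≤ m) z≡1+x (toℕ<n z)))))
  where
  z≡1+x : toℕ z ≡ suc (toℕ x)
  z≡1+x = trans (sym x+1≡z) (+-comm (toℕ x) 1)
step-source-InUVI (x-term infinite y≡m-1) = inj₂ (inj₂ y≡m-1)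

edge-source-InUVI : ∀ {m} {u v : Vertex m} → Edge m u v → InUVI u
edge-source-InUVI {u = u} {v} e = step-source-InUVI (edge⇒step {u = u} {v} e)

¬InUVI⇒sink : ∀ {m} {v : Vertex m} → ¬ InUVI v → Sink (Edge m) v
¬InUVI⇒sink {v = v} v∉UVI w e = v∉UVI (edge-source-InUVI {u = v} {w} e)

∞∞-sink : ∀ {m} → Sink (Edge m) (∞ , ∞)
∞∞-sink {m} = ¬InUVI⇒sink {m} {∞ , ∞} λ { (inj₁ ()) ; (inj₂ (inj₁ ())) ; (inj₂ (inj₂ ())) }

U-closedUpToSinks : ∀ {m} → ClosedUpToSinks (Edge m) InU
U-closedUpToSinks {u = u} {w} Uu e = step-closed Uu (edge⇒step {u = u} {w} e)
  where
  step-closed : ∀ {m} {u w : Vertex m} → InU u → Step m u w → InU w ⊎ Sink (Edge m) w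
  step-closed {u = fin _ , ∞} _ (c-term {p = fin _} _ _ infinite _) = inj₁ tt
  step-closed {m} {u = fin _ , ∞} _ (c-term {p = ∞} _ _ infinite _) = inj₂ (∞∞-sink {m})

I-closedUpToSinks : ∀ {m} → ClosedUpToSinks (Edge m) InI
I-closedUpToSinks {u = u} {w} Iu e = step-closed Iu (edge⇒step {u = u} {w} e)
  where
  step-closed : ∀ {m} {u w : Vertex m} → InI u → Step m u w → InI w ⊎ Sink (Edge m) w
  step-closed {m} {u = ∞ , fin _} _ (x-term {q = ∞} infinite _) = inj₂ (∞∞-sink {m})
  step-closed {m} {u = ∞ , fin _} _ (x-term {q = fin z} infinite _) with toℕ z ≟ m ∸ 1
  ... | yes z≡m-1 = inj₁ z≡m-1
  ... | no z≢m-1 =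
    inj₂ (¬InUVI⇒sink {m} {∞ , fin z}
            λ { (inj₁ ()) ; (inj₂ (inj₁ ())) ; (inj₂ (inj₂ z≡m-1)) → z≢m-1 z≡m-1 })

U-SCC-closed : ∀ {m} {u v : Vertex m} → InU u → SameSCC m u v → InU v
U-SCC-closed {m} Uu (u→v , v→u) = closedUpToSinks⇒SCC-closed (Edge m) U-closedUpToSinks Uu u→v v→u

I-SCC-closed : ∀ {m} {u v : Vertex m} → InI u → SameSCC m u v → InI v
I-SCC-closed {m} Iu (u→v , v→u) = closedUpToSinks⇒SCC-closed (Edge m) I-closedUpToSinks Iu u→v v→u

InU⇒¬InV : ∀ {m} {v : Vertex m} → InU v → ¬ InV v
InU⇒¬InV {v = fin _ , ∞} _ ()

InI⇒¬InV : ∀ {m} {v : Vertex m} → InI v → ¬ InV v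
InI⇒¬InV {v = ∞ , fin _} _ ()

-- If v ≠ u then v has an out-edge, so v ∈ U ∪ V ∪ I; and v ∈ U or v ∈ I would force u into
-- the same set.
V-SCC-closed : ∀ {m} {u v : Vertex m} → InV u → SameSCC m u v → InV v
V-SCC-closed Vu (_ , ε) = Vu
V-SCC-closed {v = v} Vu (u→v , _◅_ {j = w} e w→u) with edge-source-InUVI {u = v} {w} e
... | inj₁ Uv = contradiction Vu (InU⇒¬InV (U-SCC-closed Uv (e ◅ w→u , u→v)))
... | inj₂ (inj₁ Vv) = Vv
... | inj₂ (inj₂ Iv) = contradiction Vu (InI⇒¬InV (I-SCC-closed Iv (e ◅ w→u , u→v)))

onCycle⇒InUVI : ∀ {m} {v : Vertex m} → OnCycle m v → InUVI v
onCycle⇒InUVI {v = v} ([_] {y = w} e) = edge-source-InUVI {u = v} {w} e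
onCycle⇒InUVI {v = v} (_∷_ {y = w} e _) = edge-source-InUVI {u = v} {w} e

c-step : ∀ {m x s p q} k → toℕ x + suc k ≡ m → Minus q (suc k) s → k ≤ toℕ p →
         Step m (fin x , s) (fin p , q)
c-step k x+k≡m q-k≡s k≤p = c-term k x+k≡m q-k≡s (c-pos k≤p)

steps⇒reach : ∀ {m} {u v : Vertex m} → Star (Step m) u v → Reach m u v
steps⇒reach {m} = Star.map (step⇒edge {m})

+-suc-∸ : ∀ {a n} → a ≤ n → a + suc (n ∸ a) ≡ suc n
+-suc-∸ {a} {n} a≤n = trans (+-suc a (n ∸ a)) (cong suc (m+[n∸m]≡n a≤n))

U-strongly-connected : ∀ {n} {u v : Vertex (suc n)} → InU u → InU v → SameSCC (suc n) u v
U-strongly-connected {n} {fin a , ∞} {fin b , ∞} _ _ =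
  steps⇒reach (to-top a ◅ from-top b ◅ ε) , steps⇒reach (to-top b ◅ from-top a ◅ ε)
  where
  top : Fin (suc n)
  top = fromℕ n

  to-top : ∀ a → Step (suc n) (fin a , ∞) (fin top , ∞)
  to-top a = c-step (n ∸ toℕ a) (+-suc-∸ (toℕ≤pred[n] a)) infinite
                    (subst (n ∸ toℕ a ≤_) (sym (toℕ-fromℕ n)) (m∸n≤m n (toℕ a)))

  from-top : ∀ b → Step (suc n) (fin top , ∞) (fin b , ∞)
  from-top b = c-step 0 (trans (cong (_+ 1) (toℕ-fromℕ n)) (+-comm n 1)) infinite z≤n

I-strongly-connected : ∀ {m} {u v : Vertex m} → InI u → InI v → SameSCC m u v
I-strongly-connected {u = ∞ , fin _} {∞ , fin _} Iu Iv =
  steps⇒reach (x-term infinite Iu ◅ ε) , steps⇒reach (x-term infinite Iv ◅ ε)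

I-self-loop : ∀ {m} {v : Vertex m} → InI v → Edge m v v
I-self-loop {v = v@(∞ , fin _)} Iv = step⇒edge {u = v} {v} (x-term infinite Iv)

module _ {n : ℕ} where

  private
    m : ℕ
    m = suc (suc n)

    top mid : Fin m
    top = fromℕ (suc n)
    mid = inject₁ (fromℕ n)

    top≡ : toℕ top ≡ suc n
    top≡ = toℕ-fromℕ (suc n)

    mid≡ : toℕ mid ≡ n
    mid≡ = trans (toℕ-inject₁ (fromℕ n)) (toℕ-fromℕ n)

    mid+1≡top : toℕ mid + 1 ≡ toℕ top
    mid+1≡top = trans (cong (_+ 1) mid≡) (trans (+-comm n 1) (sym top≡))

  V-hub : Vertex m
  V-hub = fin top , fin mid

  V-hub∈V : InV V-hub
  V-hub∈V = inj₁ (subst₂ _<_ (sym mid≡) (sym top≡) (n<1+n n))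

  private
    hub→last-column : ∀ {a y} → toℕ y ≡ suc n → Step m V-hub (fin a , fin y)
    hub→last-column y≡ =
      c-step 0 (trans (cong (_+ 1) top≡) (+-comm (suc n) 1))
               (finite (trans mid+1≡top (trans top≡ (sym y≡)))) z≤n

    last-column→next-column : ∀ {a a′ y q} → toℕ y ≡ suc n → toℕ a + 1 ≡ toℕ a′ →
                              Step m (fin a , fin y) (fin a′ , q)
    last-column→next-column y≡ a+1≡a′ = x-term (finite a+1≡a′) y≡

    penultimate→hub : Step m (fin mid , fin top) V-hub
    penultimate→hub = last-column→next-column top≡ mid+1≡top

    diagonal→hub : ∀ {x y} → toℕ x ≡ suc (toℕ y) → Star (Step m) (fin x , fin y) V-hub
    diagonal→hub {x} {y} x≡1+y = c-step k x+k≡m (finite y+k≡top) k≤mid ◅ penultimate→hub ◅ ε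
      where
      y≤n : toℕ y ≤ n
      y≤n = ≤-pred (≤-pred (subst (_< m) x≡1+y (toℕ<n x)))
      k : ℕ
      k = n ∸ toℕ y
      x+k≡m : toℕ x + suc k ≡ m
      x+k≡m = trans (cong (_+ suc k) x≡1+y) (cong suc (+-suc-∸ y≤n))
      y+k≡top : toℕ y + suc k ≡ toℕ top
      y+k≡top = trans (+-suc-∸ y≤n) (sym top≡)
      k≤mid : k ≤ toℕ mid
      k≤mid = subst (k ≤_) (sym mid≡) (m∸n≤m n (toℕ y))

    below-diagonal→hub : ∀ {a b} → toℕ b < toℕ a → Star (Step m) (fin a , fin b) V-hub
    below-diagonal→hub {a} {b} b<a = via (t ≟ suc n)
      where
      k t : ℕ
      k = suc n ∸ toℕ a
      t = toℕ b + suc k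

      a+k≡m : toℕ a + suc k ≡ m
      a+k≡m = +-suc-∸ (toℕ≤pred[n] a)

      t<m : t < m
      t<m = subst (t <_) a+k≡m (+-monoˡ-< (suc k) b<a)

      via : Dec (t ≡ suc n) → Star (Step m) (fin a , fin b) V-hub
      via (yes t≡1+n) = c-step k a+k≡m (finite (trans t≡1+n (sym top≡))) k≤mid ◅ penultimate→hub ◅ ε
        where
        k≤mid : k ≤ toℕ mid
        k≤mid = subst (k ≤_) (sym mid≡) (∸-monoʳ-≤ (suc n) (≤-trans (s≤s z≤n) b<a))
      via (no t≢1+n) = c-step k a+k≡m (finite (sym (toℕ-fromℕ< t<m))) k≤t+1 ◅ diagonal→hub t+1≡1+t
        where
        t<1+n : t < suc n
        t<1+n = ≤∧≢⇒< (≤-pred t<m) t≢1+n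
        t+1≡1+t : toℕ (fromℕ< (s≤s t<1+n)) ≡ suc (toℕ (fromℕ< t<m))
        t+1≡1+t = trans (toℕ-fromℕ< (s≤s t<1+n)) (cong suc (sym (toℕ-fromℕ< t<m)))
        k≤t+1 : k ≤ toℕ (fromℕ< (s≤s t<1+n))
        k≤t+1 = subst (k ≤_) (sym (toℕ-fromℕ< (s≤s t<1+n)))
                  (≤-trans (n≤1+n k) (≤-trans (m≤n+m (suc k) (toℕ b)) (n≤1+n t)))

    last-column→hub : ∀ {a y} → toℕ y ≡ suc n → toℕ a ≤ n → Star (Step m) (fin a , fin y) V-hub
    last-column→hub {a} y≡ a≤n =
      last-column→next-column {a′ = a′} {q = fin a} y≡ (trans (+-comm (toℕ a) 1) (sym a′≡1+a))
        ◅ diagonal→hub a′≡1+a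
      where
      a′ : Fin m
      a′ = fromℕ< (s≤s (s≤s a≤n))
      a′≡1+a : toℕ a′ ≡ suc (toℕ a)
      a′≡1+a = toℕ-fromℕ< (s≤s (s≤s a≤n))

  V→hub : ∀ {v} → InV v → Star (Step m) v V-hub
  V→hub {fin a , fin b} (inj₁ b<a) = below-diagonal→hub b<a
  V→hub {fin a , fin y} (inj₂ (y≡ , a≤n)) = last-column→hub y≡ a≤n

  hub→V : ∀ {v} → InV v → Star (Step m) V-hub v
  hub→V {fin a , fin y} (inj₂ (y≡ , _)) = hub→last-column y≡ ◅ ε
  hub→V {fin zero , fin b} (inj₁ ())
  hub→V {fin (suc a) , fin b} (inj₁ _) =
    hub→last-column {a = inject₁ a} top≡ ◅ last-column→next-column top≡ a+1≡1+a ◅ ε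
    where
    a+1≡1+a : toℕ (inject₁ a) + 1 ≡ suc (toℕ a)
    a+1≡1+a = trans (cong (_+ 1) (toℕ-inject₁ a)) (+-comm (toℕ a) 1)

  V-strongly-connected : ∀ {u v} → InV u → InV v → SameSCC m u v
  V-strongly-connected Vu Vv =
    steps⇒reach (V→hub Vu ◅◅ hub→V Vv) , steps⇒reach (V→hub Vv ◅◅ hub→V Vu)

proposition2p7 : (m : ℕ) → 2 ≤ m →
    IsSCC m InU
    × IsSCC m InV
    × IsSCC m InI × (∀ v → InI v → Edge m v v)
    × (∀ v → ¬ (InU v ⊎ InV v ⊎ InI v) →
         ¬ Edge m v v × (∀ w → SameSCC m v w → w ≡ v))
    × (∀ v → OnCycle m v → InU v ⊎ InV v ⊎ InI v)
proposition2p7 m@(suc (suc n)) (s≤s (s≤s z≤n)) =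
    (((fin zero , ∞) , tt)
      , (λ u v → U-strongly-connected {u = u} {v}) , λ u v → U-SCC-closed {u = u} {v})
  , ((V-hub , V-hub∈V)
      , (λ u v → V-strongly-connected {u = u} {v}) , λ u v → V-SCC-closed {u = u} {v})
  , (((∞ , fin (fromℕ (suc n))) , toℕ-fromℕ (suc n))
      , (λ u v → I-strongly-connected {u = u} {v}) , λ u v → I-SCC-closed {u = u} {v})
  , (λ v → I-self-loop {v = v})
  , (λ v v∉UVI → ¬InUVI⇒sink v∉UVI v , λ w (v→w , _) → sink-reach (Edge m) (¬InUVI⇒sink v∉UVI) v→w)
  , λ v → onCycle⇒InUVI {v = v}
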